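{- For every finite simple graph $G$ and every positive integer $t$, the graph $M(G^t)$ is isomorphic to a subgraph of $[M(G)]^t$.
   Context: For a graph $H$, $H^t$ is its $t$-fold OR-power: vertex set $V(H)^t$, two distinct sequences adjacent iff in at least one coordinate their entries are adjacent in $H$. The Mycielskian $M(H)$ has vertex set $V(H)\times\{0,1\}\cup\{z\}$ ($z$ a new vertex) and edge set $\{\{(v,0),(w,i)\}:\{v,w\}\in E(H),\ i\in\{0,1\}\}\cup\{\{z,(v,1)\}: v\in V(H)\}$. -}

module Defs where

open import Data.Nat using (ℕ)
open import Data.Fin using (Fin)
open import Data.Bool using (Bool; true; false)
open import Data.Unit using (⊤; tt)
open import Data.Sum using (_⊎_; inj₁; inj₂)
open import Data.Product using (Σ; ∃; _×_; _,_)
open import Data.Vec using (Vec; lookup)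
open import Relation.Nullary using (¬_)
open import Relation.Binary.PropositionalEquality using (_≡_; _≢_; refl; sym)
open import Function.Definitions using (Injective)

record Graph (V : Set) : Set₁ where
  field
    Adj    : V → V → Set
    symm   : ∀ {u v} → Adj u v → Adj v u
    irrefl : ∀ {v} → ¬ Adj v v
open Graph public

FinGraph : ℕ → Set₁
FinGraph n = Graph (Fin n)

PowAdj : ∀ {V} → Graph V → (t : ℕ) → Vec V t → Vec V t → Set
PowAdj H t x y = (x ≢ y) × ∃ λ (i : Fin t) → Adj H (lookup x i) (lookup y i)

_^OR_ : ∀ {V} → Graph V → (t : ℕ) → Graph (Vec V t)
Adj (H ^OR t) = PowAdj H t
symm (H ^OR t) (x≢y , i , a) = (λ e → x≢y (sym e)) , i , symm H a
irrefl (H ^OR t) (x≢x , _) = x≢x refl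

-- Mycielskian: vertices V × {0,1} (0 = false, 1 = true) plus a new vertex z = inj₂ tt.
MV : Set → Set
MV V = (V × Bool) ⊎ ⊤

-- Edges {(v,0),(w,i)} for vw ∈ E(H), i ∈ {0,1}, and {z,(v,1)}; listed in both orientations.
data MAdj {V : Set} (H : Graph V) : MV V → MV V → Set where
  e00 : ∀ {v w} → Adj H v w → MAdj H (inj₁ (v , false)) (inj₁ (w , false))
  e01 : ∀ {v w} → Adj H v w → MAdj H (inj₁ (v , false)) (inj₁ (w , true))
  e10 : ∀ {v w} → Adj H v w → MAdj H (inj₁ (w , true)) (inj₁ (v , false))
  ez1 : ∀ {v} → MAdj H (inj₂ tt) (inj₁ (v , true))
  e1z : ∀ {v} → MAdj H (inj₁ (v , true)) (inj₂ tt)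

Myc : ∀ {V} → Graph V → Graph (MV V)
Adj (Myc H) = MAdj H
symm (Myc H) (e00 a) = e00 (symm H a)
symm (Myc H) (e01 a) = e10 a
symm (Myc H) (e10 a) = e01 a
symm (Myc H) ez1 = e1z
symm (Myc H) e1z = ez1
irrefl (Myc H) (e00 a) = irrefl H a

_⊑_ : ∀ {V W} → Graph V → Graph W → Set
_⊑_ {V} {W} A B = Σ (V → W) λ f → Injective _≡_ _≡_ f × (∀ {u v} → Adj A u v → Adj B (f u) (f v))

{-# OPTIONS --safe #-}
module Submission where

open import Defs
open import Data.Nat using (ℕ; _≤_; suc; s≤s)
open import Data.Fin using (Fin; zero)
open import Data.Unit using (tt)
open import Data.Sum using (inj₁; inj₂)
open import Data.Product using (∃; _,_)
open import Data.Sum.Properties using (inj₁-injective)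
open import Data.Product.Properties using (,-injectiveˡ; ,-injectiveʳ)
open import Data.Vec using (Vec; lookup; tabulate)
open import Data.Vec.Properties using (lookup∘tabulate; tabulate∘lookup; tabulate-cong)
open import Function.Definitions using (Injective)
open import Relation.Binary.PropositionalEquality
  using (_≡_; refl; sym; cong; cong₂; subst₂; module ≡-Reasoning)

-- Embed M(H^t) into M(H)^t by (x, b) ↦ ((x₁, b), …, (xₜ, b)) and z ↦ (z, …, z), which is
-- injective once t ≥ 1.  An edge of M(H^t) through (x, b) and (y, c) comes from an edge
-- xᵢyᵢ of H in some coordinate i, and that coordinate of the image is an edge of M(H); an
-- edge at z is an edge of M(H) in every coordinate, so again t ≥ 1 supplies one.

lookup-extensionality : ∀ {A : Set} {t} {x y : Vec A t} →
                        (∀ i → lookup x i ≡ lookup y i) → x ≡ y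
lookup-extensionality {x = x} {y} pointwise = begin
  x                   ≡⟨ sym (tabulate∘lookup x) ⟩
  tabulate (lookup x) ≡⟨ tabulate-cong pointwise ⟩
  tabulate (lookup y) ≡⟨ tabulate∘lookup y ⟩
  y                   ∎
  where open ≡-Reasoning

Adj-lookup⇒PowAdj : ∀ {V} (H : Graph V) {t} {x y : Vec V t} (i : Fin t) →
                    Adj H (lookup x i) (lookup y i) → PowAdj H t x y
Adj-lookup⇒PowAdj H i adj = (λ { refl → irrefl H adj }) , i , adj

module _ {V : Set} where

  coordinate : ∀ {t} → MV (Vec V t) → Fin t → MV V
  coordinate (inj₁ (x , b)) i = inj₁ (lookup x i , b)
  coordinate (inj₂ tt)      i = inj₂ tt

  coordinate-injective : ∀ {m} {u v : MV (Vec V (suc m))} →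
                         (∀ i → coordinate u i ≡ coordinate v i) → u ≡ v
  coordinate-injective {u = inj₁ (x , b)} {inj₁ (y , c)} same =
    cong₂ (λ w d → inj₁ (w , d))
          (lookup-extensionality λ i → ,-injectiveˡ (inj₁-injective (same i)))
          (,-injectiveʳ (inj₁-injective (same zero)))
  coordinate-injective {u = inj₁ _} {inj₂ tt} same with same zero
  ... | ()
  coordinate-injective {u = inj₂ tt} {inj₁ _} same with same zero
  ... | ()
  coordinate-injective {u = inj₂ tt} {inj₂ tt} _ = refl

  embed : ∀ {t} → MV (Vec V t) → Vec (MV V) t
  embed u = tabulate (coordinate u)

  lookup-embed : ∀ {t} (u : MV (Vec V t)) i → lookup (embed u) i ≡ coordinate u i
  lookup-embed u = lookup∘tabulate (coordinate u)

  embed-injective : ∀ {m} → Injective _≡_ _≡_ (embed {suc m})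
  embed-injective {x = u} {v} eq = coordinate-injective λ i → begin
    coordinate u i      ≡⟨ sym (lookup-embed u i) ⟩
    lookup (embed u) i  ≡⟨ cong (λ w → lookup w i) eq ⟩
    lookup (embed v) i  ≡⟨ lookup-embed v i ⟩
    coordinate v i      ∎
    where open ≡-Reasoning

module _ {V : Set} (H : Graph V) where

  MAdj-coordinate : ∀ {m} {u v : MV (Vec V (suc m))} → MAdj (H ^OR suc m) u v →
                    ∃ λ i → MAdj H (coordinate u i) (coordinate v i)
  MAdj-coordinate (e00 (_ , i , adj)) = i , e00 adj
  MAdj-coordinate (e01 (_ , i , adj)) = i , e01 adj
  MAdj-coordinate (e10 (_ , i , adj)) = i , e10 adj
  MAdj-coordinate ez1                 = zero , ez1
  MAdj-coordinate e1z                 = zero , e1z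

  embed-preserves-Adj : ∀ {m} {u v : MV (Vec V (suc m))} → MAdj (H ^OR suc m) u v →
                        PowAdj (Myc H) (suc m) (embed u) (embed v)
  embed-preserves-Adj {u = u} {v} adj with MAdj-coordinate adj
  ... | i , adjᵢ = Adj-lookup⇒PowAdj (Myc H) i
    (subst₂ (MAdj H) (sym (lookup-embed u i)) (sym (lookup-embed v i)) adjᵢ)

  Myc-^OR⊑^OR-Myc : ∀ m → Myc (H ^OR suc m) ⊑ (Myc H ^OR suc m)
  Myc-^OR⊑^OR-Myc m = embed , embed-injective , embed-preserves-Adj

lemma2 : (n : ℕ) (G : FinGraph n) (t : ℕ) → 1 ≤ t → Myc (G ^OR t) ⊑ (Myc G ^OR t)
lemma2 n G (suc m) (s≤s _) = Myc-^OR⊑^OR-Myc G m
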